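{- Let $\mathcal{A}$ be a finite group and let $\alpha\in\mathrm{Aut}(\mathcal{A})$. Then $$\sum_{\Omega\in\mathrm{Fix}_\alpha(\mathcal{A})}x^{|\Omega|}=\sum_{K\le\mathcal{A}}\mu(K)\left(\sum_{\Omega\in S(K),\ \alpha(\Omega)=\Omega}x^{|\Omega|}\right),$$ where $K$ runs over all subgroups of $\mathcal{A}$.
   Context: Let $e$ be the identity of $\mathcal{A}$. $G(\mathcal{A})=\{\Omega\subseteq\mathcal{A}:\Omega^{ -1}=\Omega,\ \langle\Omega\rangle=\mathcal{A},\ e\notin\Omega\}$ and $\mathrm{Fix}_\alpha(\mathcal{A})=\{\Omega\in G(\mathcal{A}):\alpha(\Omega)=\Omega\}$. For a subgroup $K\le\mathcal{A}$, $S(K)=\{\Omega\subseteq K:\Omega=\Omega^{ -1},\ e\notin\Omega\}$ (the empty set included). The Möbius function $\mu$ on the subgroup lattice of $\mathcal{A}$ assigns to each subgroup $K$ an integer $\mu(K)$ defined recursively by $\sum_{H\ge K}\mu(H)=1$ if $K=\mathcal{A}$ and $=0$ if $K<\mathcal{A}$, the sum over subgroups $H$ of $\mathcal{A}$ containing $K$. -}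

module Defs where

open import Data.Nat using (ℕ; zero; suc; _≡ᵇ_)
open import Data.Integer using (ℤ; _+_; _*_; 0ℤ; 1ℤ)
open import Data.Bool using (Bool; true; false; _∧_; _∨_; not; if_then_else_)
import Data.Bool as B
open import Data.Fin using (Fin)
import Data.Fin.Properties as FinP
open import Data.Fin.Subset using (Subset; _∈_; ∣_∣)
open import Data.Vec using (Vec; []; _∷_; lookup; tabulate)
open import Data.List using (List; []; _∷_; [_]; _++_; map; foldr; filter; allFin)
open import Data.Bool.ListAction using (all; any)
open import Relation.Nullary.Decidable using (⌊_⌋)
open import Relation.Binary.PropositionalEquality using (_≡_)
open import Algebra.Structures using (IsGroup)
open import Data.Product using (_×_)
open import Function.Definitions using (Bijective)

-- A finite group of order n, presented on the carrier Fin n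
-- (every finite group is isomorphic to such a one), with
-- propositional equality as the group equality.

record FinGroup (n : ℕ) : Set where
  field
    _∙_     : Fin n → Fin n → Fin n
    e       : Fin n
    _⁻¹     : Fin n → Fin n
    isGroup : IsGroup _≡_ _∙_ e _⁻¹

allF : ∀ {n} → (Fin n → Bool) → Bool
allF {n} p = all p (allFin n)

anyF : ∀ {n} → (Fin n → Bool) → Bool
anyF {n} p = any p (allFin n)

_==_ : ∀ {n} → Fin n → Fin n → Bool
x == y = ⌊ x FinP.≟ y ⌋

_⇒b_ : Bool → Bool → Bool
a ⇒b b = not a ∨ b

mem : ∀ {n} → Fin n → Subset n → Bool
mem x Ω = lookup Ω x

_=ˢ_ : ∀ {n} → Subset n → Subset n → Bool
Ω =ˢ Θ = allF (λ x → ⌊ mem x Ω B.≟ mem x Θ ⌋)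

_⊆ˢ_ : ∀ {n} → Subset n → Subset n → Bool
Ω ⊆ˢ Θ = allF (λ x → mem x Ω ⇒b mem x Θ)

fullˢ : ∀ {n} → Subset n
fullˢ = tabulate (λ _ → true)

image : ∀ {n} → (Fin n → Fin n) → Subset n → Subset n
image f Ω = tabulate (λ y → anyF (λ x → mem x Ω ∧ (f x == y)))

allSubsets : (n : ℕ) → List (Subset n)
allSubsets zero    = [ [] ]
allSubsets (suc n) = map (true ∷_) (allSubsets n) ++ map (false ∷_) (allSubsets n)

module _ {n : ℕ} (G : FinGroup n) where
  open FinGroup G

  isSubgroup : Subset n → Bool
  isSubgroup K =
    mem e K
    ∧ allF (λ x → allF (λ y → (mem x K ∧ mem y K) ⇒b mem (x ∙ y) K))
    ∧ allF (λ x → mem x K ⇒b mem (x ⁻¹) K)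

  subgroups : List (Subset n)
  subgroups = filter (λ K → isSubgroup K B.≟ true) (allSubsets n)

  -- ⟨Ω⟩ = A : the intersection of all subgroups containing Ω is A,
  -- i.e. every subgroup containing Ω is the whole group
  generates : Subset n → Bool
  generates Ω = all (λ K → (Ω ⊆ˢ K) ⇒b (K =ˢ fullˢ)) subgroups

  symmetricNoE : Subset n → Bool
  symmetricNoE Ω = (image _⁻¹ Ω =ˢ Ω) ∧ not (mem e Ω)

  inG : Subset n → Bool
  inG Ω = symmetricNoE Ω ∧ generates Ω

  -- S(K) = { Ω ⊆ K : Ω = Ω⁻¹, e ∉ Ω }  (empty set included)
  inS : Subset n → Subset n → Bool
  inS K Ω = (Ω ⊆ˢ K) ∧ symmetricNoE Ω

  IsAutomorphism : (Fin n → Fin n) → Set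
  IsAutomorphism α =
    (∀ x y → α (x ∙ y) ≡ α x ∙ α y)
    × Bijective _≡_ _≡_ α

  IsMobius : (Subset n → ℤ) → Set
  IsMobius μ =
    ∀ K → isSubgroup K ≡ true →
      foldr _+_ 0ℤ (map μ (filter (λ H → (K ⊆ˢ H) B.≟ true) subgroups))
      ≡ (if K =ˢ fullˢ then 1ℤ else 0ℤ)

-- Polynomials in x with integer coefficients, as coefficient functions

Poly : Set
Poly = ℕ → ℤ

X^ : ℕ → Poly
X^ k j = if j ≡ᵇ k then 1ℤ else 0ℤ

0ₚ : Poly
0ₚ _ = 0ℤ

_+ₚ_ : Poly → Poly → Poly
(p +ₚ q) j = p j + q j

_•ₚ_ : ℤ → Poly → Poly
(c •ₚ p) j = c * p j

Σₚ : ∀ {A : Set} → List A → (A → Poly) → Poly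
Σₚ xs f = foldr (λ a acc → f a +ₚ acc) 0ₚ xs

-- A subset Ω generates the group exactly when the subgroup ⟪Ω⟫ it generates is the whole
-- group, and Ω ⊆ H ⟺ ⟪Ω⟫ ⊆ H for every subgroup H. Hence, by the defining property of
-- the Möbius function, Σ_{H ⊇ Ω} μ(H) is 1 if Ω generates and 0 otherwise. Multiplying
-- by the weight of Ω and exchanging the two sums turns the right-hand side into the
-- left-hand side.
module Submission where

open import Defs
open import Data.Nat using (ℕ)
open import Data.Integer using (ℤ; _+_; _*_; 0ℤ; 1ℤ)
import Data.Integer.Properties as ℤ
open import Data.Fin using (Fin)
open import Data.Fin.Subset using (Subset; ∣_∣; _∈_; _⊆_)
open import Data.Bool using (Bool; true; false; if_then_else_; _∧_)
import Data.Bool as Bool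
open import Data.Bool.Properties using (∧-conicalˡ; ∧-conicalʳ; ∧-assoc; ∧-comm; T-≡; ⇔→≡; if-∧; if-cong; if-float)
open import Data.Bool.ListAction using (all)
open import Data.List using (List; []; _∷_; map; foldr; filter; allFin)
open import Data.List.Membership.Propositional using () renaming (_∈_ to _∈ₗ_)
open import Data.List.Membership.Propositional.Properties using (∈-filter⁺; ∈-filter⁻; ∈-map⁺; ∈-++⁺ˡ; ∈-++⁺ʳ; ∈-allFin)
open import Data.List.Relation.Unary.Any using (here; there)
open import Data.List.Relation.Unary.All using (All)
import Data.List.Relation.Unary.All as All
open import Data.List.Relation.Unary.All.Properties using (all⁺; all⁻)
open import Data.Vec using ([]; _∷_; tabulate)
open import Data.Vec.Properties using (lookup∘tabulate; []=⇒lookup; lookup⇒[]=)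
open import Data.Product using (_,_; proj₂)
open import Function using (_∘_)
open import Function.Bundles using (mk⇔; Equivalence)
open import Relation.Nullary.Decidable using (⌊_⌋; toWitness; fromWitness)
open import Relation.Binary.PropositionalEquality using (_≡_; refl; sym; trans; cong; cong₂; module ≡-Reasoning)
open import Algebra.Properties.CommutativeSemigroup ℤ.+-commutativeSemigroup using (interchange)

open Equivalence using (to; from)

∧-true : ∀ {a b} → a ≡ true → b ≡ true → a ∧ b ≡ true
∧-true refl refl = refl

⇒b-elim : ∀ {a b} → a ⇒b b ≡ true → a ≡ true → b ≡ true
⇒b-elim {true} h _ = h

⇒b-intro : ∀ {a b} → (a ≡ true → b ≡ true) → a ⇒b b ≡ true
⇒b-intro {false} _ = refl
⇒b-intro {true}  f = f refl

all-true⇒All : ∀ {A : Set} (p : A → Bool) xs → all p xs ≡ true → All (λ x → p x ≡ true) xs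
all-true⇒All p xs h = All.map (to T-≡) (all⁺ p xs (from T-≡ h))

All⇒all-true : ∀ {A : Set} (p : A → Bool) {xs} → All (λ x → p x ≡ true) xs → all p xs ≡ true
All⇒all-true p ps = to T-≡ (all⁻ p (All.map (from T-≡) ps))

allF-true⇒ : ∀ {n} (p : Fin n → Bool) → allF p ≡ true → ∀ x → p x ≡ true
allF-true⇒ {n} p h x = All.lookup (all-true⇒All p (allFin n) h) (∈-allFin x)

⇒allF-true : ∀ {n} (p : Fin n → Bool) → (∀ x → p x ≡ true) → allF p ≡ true
⇒allF-true {n} p f = All⇒all-true p {allFin n} (All.tabulate (λ {x} _ → f x))

module _ {n : ℕ} where

  mem⇒∈ : ∀ {x} {Ω : Subset n} → mem x Ω ≡ true → x ∈ Ω
  mem⇒∈ {x} {Ω} = lookup⇒[]= x Ω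

  ∈⇒mem : ∀ {x} {Ω : Subset n} → x ∈ Ω → mem x Ω ≡ true
  ∈⇒mem = []=⇒lookup

  ⊆ˢ⇒⊆ : ∀ {Ω Θ : Subset n} → Ω ⊆ˢ Θ ≡ true → Ω ⊆ Θ
  ⊆ˢ⇒⊆ {Ω} {Θ} h {x} x∈Ω =
    mem⇒∈ (⇒b-elim (allF-true⇒ (λ y → mem y Ω ⇒b mem y Θ) h x) (∈⇒mem x∈Ω))

  ⊆⇒⊆ˢ : ∀ {Ω Θ : Subset n} → Ω ⊆ Θ → Ω ⊆ˢ Θ ≡ true
  ⊆⇒⊆ˢ {Ω} {Θ} Ω⊆Θ =
    ⇒allF-true (λ y → mem y Ω ⇒b mem y Θ) (λ x → ⇒b-intro (∈⇒mem ∘ Ω⊆Θ ∘ mem⇒∈))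

  mem-fullˢ : ∀ (x : Fin n) → mem x fullˢ ≡ true
  mem-fullˢ = lookup∘tabulate (λ _ → true)

  =fullˢ⇒full : ∀ {Ω : Subset n} → Ω =ˢ fullˢ ≡ true → ∀ x → x ∈ Ω
  =fullˢ⇒full {Ω} h x =
    mem⇒∈ (trans (toWitness (from T-≡ (allF-true⇒ (λ y → ⌊ mem y Ω Bool.≟ mem y fullˢ ⌋) h x)))
                 (mem-fullˢ x))

  full⇒=fullˢ : ∀ {Ω : Subset n} → (∀ x → x ∈ Ω) → Ω =ˢ fullˢ ≡ true
  full⇒=fullˢ {Ω} f = ⇒allF-true (λ y → ⌊ mem y Ω Bool.≟ mem y fullˢ ⌋)
    (λ x → to T-≡ (fromWitness (trans (∈⇒mem (f x)) (sym (mem-fullˢ x)))))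

∈-allSubsets : ∀ n (Ω : Subset n) → Ω ∈ₗ allSubsets n
∈-allSubsets ℕ.zero    []          = here refl
∈-allSubsets (ℕ.suc n) (true ∷ Ω)  = ∈-++⁺ˡ (∈-map⁺ (true ∷_) (∈-allSubsets n Ω))
∈-allSubsets (ℕ.suc n) (false ∷ Ω) =
  ∈-++⁺ʳ (map (true ∷_) (allSubsets n)) (∈-map⁺ (false ∷_) (∈-allSubsets n Ω))

sumℤ : ∀ {A : Set} → List A → (A → ℤ) → ℤ
sumℤ xs f = foldr (λ a acc → f a + acc) 0ℤ xs

module _ {A : Set} where

  sumℤ-cong : ∀ (xs : List A) {f g : A → ℤ} → (∀ {x} → x ∈ₗ xs → f x ≡ g x) → sumℤ xs f ≡ sumℤ xs g
  sumℤ-cong []       f≗g = refl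
  sumℤ-cong (x ∷ xs) f≗g = cong₂ _+_ (f≗g (here refl)) (sumℤ-cong xs (f≗g ∘ there))

  sumℤ-zero : ∀ (xs : List A) → sumℤ xs (λ _ → 0ℤ) ≡ 0ℤ
  sumℤ-zero []       = refl
  sumℤ-zero (x ∷ xs) = trans (ℤ.+-identityˡ _) (sumℤ-zero xs)

  sumℤ-distrib-+ : ∀ (xs : List A) (f g : A → ℤ) → sumℤ xs (λ x → f x + g x) ≡ sumℤ xs f + sumℤ xs g
  sumℤ-distrib-+ []       f g = refl
  sumℤ-distrib-+ (x ∷ xs) f g =
    trans (cong (f x + g x +_) (sumℤ-distrib-+ xs f g)) (interchange (f x) (g x) (sumℤ xs f) (sumℤ xs g))

  *-distribˡ-sumℤ : ∀ (c : ℤ) (xs : List A) (f : A → ℤ) → c * sumℤ xs f ≡ sumℤ xs (λ x → c * f x)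
  *-distribˡ-sumℤ c []       f = ℤ.*-zeroʳ c
  *-distribˡ-sumℤ c (x ∷ xs) f =
    trans (ℤ.*-distribˡ-+ c (f x) (sumℤ xs f)) (cong (c * f x +_) (*-distribˡ-sumℤ c xs f))

  *-distribʳ-sumℤ : ∀ (c : ℤ) (xs : List A) (f : A → ℤ) → sumℤ xs f * c ≡ sumℤ xs (λ x → f x * c)
  *-distribʳ-sumℤ c []       f = ℤ.*-zeroˡ c
  *-distribʳ-sumℤ c (x ∷ xs) f =
    trans (ℤ.*-distribʳ-+ c (f x) (sumℤ xs f)) (cong (f x * c +_) (*-distribʳ-sumℤ c xs f))

  sum-map-filter : ∀ (μ : A → ℤ) (p : A → Bool) (xs : List A) →
    foldr _+_ 0ℤ (map μ (filter (λ x → p x Bool.≟ true) xs)) ≡ sumℤ xs (λ x → if p x then μ x else 0ℤ)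
  sum-map-filter μ p []       = refl
  sum-map-filter μ p (x ∷ xs) with p x
  ... | true  = cong (μ x +_) (sum-map-filter μ p xs)
  ... | false = trans (sum-map-filter μ p xs) (sym (ℤ.+-identityˡ _))

sumℤ-comm : ∀ {A B : Set} (xs : List A) (ys : List B) (f : A → B → ℤ) →
  sumℤ xs (λ x → sumℤ ys (f x)) ≡ sumℤ ys (λ y → sumℤ xs (λ x → f x y))
sumℤ-comm []       ys f = sym (sumℤ-zero ys)
sumℤ-comm (x ∷ xs) ys f =
  trans (cong (sumℤ ys (f x) +_) (sumℤ-comm xs ys f))
        (sym (sumℤ-distrib-+ ys (f x) (λ y → sumℤ xs (λ x′ → f x′ y))))

*-indicatorʳ : ∀ (c : ℤ) b (d : ℤ) → c * (if b then d else 0ℤ) ≡ (if b then c else 0ℤ) * d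
*-indicatorʳ c true  d = refl
*-indicatorʳ c false d = trans (ℤ.*-zeroʳ c) (sym (ℤ.*-zeroˡ d))

indicator-* : ∀ b (d : ℤ) → (if b then 1ℤ else 0ℤ) * d ≡ (if b then d else 0ℤ)
indicator-* true  d = ℤ.*-identityˡ d
indicator-* false d = ℤ.*-zeroˡ d

Σₚ-coeff : ∀ {A : Set} (xs : List A) (f : A → Poly) (j : ℕ) → Σₚ xs f j ≡ sumℤ xs (λ a → f a j)
Σₚ-coeff []       f j = refl
Σₚ-coeff (x ∷ xs) f j = cong (f x j +_) (Σₚ-coeff xs f j)

Σₚ-indicator-coeff : ∀ {A : Set} (xs : List A) (p : A → Bool) (f : A → Poly) (j : ℕ) →
  Σₚ xs (λ a → if p a then f a else 0ₚ) j ≡ sumℤ xs (λ a → if p a then f a j else 0ℤ)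
Σₚ-indicator-coeff xs p f j =
  trans (Σₚ-coeff xs (λ a → if p a then f a else 0ₚ) j)
        (sumℤ-cong xs (λ {a} _ → if-float (λ q → q j) (p a) {f a} {0ₚ}))

module _ {n : ℕ} (G : FinGroup n) where
  open FinGroup G

  record IsSubgroup (K : Subset n) : Set where
    field
      e∈        : e ∈ K
      ∙-closed  : ∀ {x y} → x ∈ K → y ∈ K → x ∙ y ∈ K
      ⁻¹-closed : ∀ {x} → x ∈ K → x ⁻¹ ∈ K

  isSubgroup⇒IsSubgroup : ∀ {K} → isSubgroup G K ≡ true → IsSubgroup K
  isSubgroup⇒IsSubgroup {K} h = record
    { e∈        = mem⇒∈ (∧-conicalˡ _ _ h)
    ; ∙-closed  = λ {x} {y} x∈K y∈K →
        mem⇒∈ (⇒b-elim (allF-true⇒ _ (allF-true⇒ _ closed∙ x) y) (∧-true (∈⇒mem x∈K) (∈⇒mem y∈K)))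
    ; ⁻¹-closed = λ {x} x∈K → mem⇒∈ (⇒b-elim (allF-true⇒ _ closed⁻¹ x) (∈⇒mem x∈K))
    }
    where
    closed∙ : allF (λ x → allF (λ y → (mem x K ∧ mem y K) ⇒b mem (x ∙ y) K)) ≡ true
    closed∙ = ∧-conicalˡ _ _ (∧-conicalʳ (mem e K) _ h)
    closed⁻¹ : allF (λ x → mem x K ⇒b mem (x ⁻¹) K) ≡ true
    closed⁻¹ = ∧-conicalʳ _ _ (∧-conicalʳ (mem e K) _ h)

  IsSubgroup⇒isSubgroup : ∀ {K} → IsSubgroup K → isSubgroup G K ≡ true
  IsSubgroup⇒isSubgroup {K} K≤G = ∧-true (∈⇒mem e∈) (∧-true
    (⇒allF-true _ (λ x → ⇒allF-true (λ y → (mem x K ∧ mem y K) ⇒b mem (x ∙ y) K) (λ y →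
       ⇒b-intro (λ xy∈K →
       ∈⇒mem (∙-closed (mem⇒∈ (∧-conicalˡ _ _ xy∈K)) (mem⇒∈ (∧-conicalʳ _ _ xy∈K)))))))
    (⇒allF-true (λ x → mem x K ⇒b mem (x ⁻¹) K) (λ x → ⇒b-intro (∈⇒mem ∘ ⁻¹-closed ∘ mem⇒∈))))
    where open IsSubgroup K≤G

  ∈subgroups⇒IsSubgroup : ∀ {K} → K ∈ₗ subgroups G → IsSubgroup K
  ∈subgroups⇒IsSubgroup m =
    isSubgroup⇒IsSubgroup (proj₂ (∈-filter⁻ (λ K → isSubgroup G K Bool.≟ true) {xs = allSubsets n} m))

  IsSubgroup⇒∈subgroups : ∀ {K} → IsSubgroup K → K ∈ₗ subgroups G
  IsSubgroup⇒∈subgroups {K} K≤G =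
    ∈-filter⁺ (λ K → isSubgroup G K Bool.≟ true) (∈-allSubsets n K) (IsSubgroup⇒isSubgroup K≤G)

  ⟪_⟫ : Subset n → Subset n
  ⟪ Ω ⟫ = tabulate (λ x → all (λ K → (Ω ⊆ˢ K) ⇒b mem x K) (subgroups G))

  InEverySubgroupContaining : Subset n → Fin n → Set
  InEverySubgroupContaining Ω x = All (λ K → Ω ⊆ˢ K ≡ true → x ∈ K) (subgroups G)

  ∈⟪⟫⇒ : ∀ Ω {x} → x ∈ ⟪ Ω ⟫ → InEverySubgroupContaining Ω x
  ∈⟪⟫⇒ Ω {x} h = All.map (λ p → mem⇒∈ ∘ ⇒b-elim p)
    (all-true⇒All _ (subgroups G) (trans (sym (lookup∘tabulate _ x)) (∈⇒mem h)))

  ⇒∈⟪⟫ : ∀ Ω {x} → InEverySubgroupContaining Ω x → x ∈ ⟪ Ω ⟫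
  ⇒∈⟪⟫ Ω {x} f = mem⇒∈ (trans (lookup∘tabulate _ x)
    (All⇒all-true (λ K → (Ω ⊆ˢ K) ⇒b mem x K) (All.map (λ p → ⇒b-intro (∈⇒mem ∘ p)) f)))

  ⟪⟫-isSubgroup : ∀ Ω → IsSubgroup ⟪ Ω ⟫
  ⟪⟫-isSubgroup Ω = record
    { e∈        = ⇒∈⟪⟫ Ω (All.tabulate (λ m _ → e∈ (∈subgroups⇒IsSubgroup m)))
    ; ∙-closed  = λ x∈ y∈ → ⇒∈⟪⟫ Ω (All.tabulate (λ m Ω⊆K →
        ∙-closed (∈subgroups⇒IsSubgroup m)
          (All.lookup (∈⟪⟫⇒ Ω x∈) m Ω⊆K) (All.lookup (∈⟪⟫⇒ Ω y∈) m Ω⊆K)))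
    ; ⁻¹-closed = λ x∈ → ⇒∈⟪⟫ Ω (All.tabulate (λ m Ω⊆K →
        ⁻¹-closed (∈subgroups⇒IsSubgroup m) (All.lookup (∈⟪⟫⇒ Ω x∈) m Ω⊆K)))
    }
    where open IsSubgroup

  ⊆⟪⟫ : ∀ Ω → Ω ⊆ ⟪ Ω ⟫
  ⊆⟪⟫ Ω x∈Ω = ⇒∈⟪⟫ Ω (All.tabulate (λ _ Ω⊆K → ⊆ˢ⇒⊆ Ω⊆K x∈Ω))

  ⊆ˢ-⟪⟫ : ∀ Ω {H} → H ∈ₗ subgroups G → (Ω ⊆ˢ H) ≡ (⟪ Ω ⟫ ⊆ˢ H)
  ⊆ˢ-⟪⟫ Ω {H} m = ⇔→≡ {Ω ⊆ˢ H} {⟪ Ω ⟫ ⊆ˢ H} {true} (mk⇔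
    (λ Ω⊆H → ⊆⇒⊆ˢ (λ x∈ → All.lookup (∈⟪⟫⇒ Ω x∈) m Ω⊆H))
    (λ ⟪Ω⟫⊆H → ⊆⇒⊆ˢ (⊆ˢ⇒⊆ {Θ = H} ⟪Ω⟫⊆H ∘ ⊆⟪⟫ Ω)))

  generates≡⟪⟫=fullˢ : ∀ Ω → generates G Ω ≡ (⟪ Ω ⟫ =ˢ fullˢ)
  generates≡⟪⟫=fullˢ Ω = ⇔→≡ {generates G Ω} {⟪ Ω ⟫ =ˢ fullˢ} {true} (mk⇔
    (λ gen → ⇒b-elim (All.lookup (all-true⇒All _ (subgroups G) gen)
                                  (IsSubgroup⇒∈subgroups (⟪⟫-isSubgroup Ω)))
                     (⊆⇒⊆ˢ (⊆⟪⟫ Ω)))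
    (λ full → All⇒all-true _ (All.tabulate (λ {x = K} m → ⇒b-intro (λ Ω⊆K →
       full⇒=fullˢ {Ω = K} (λ x →
         ⊆ˢ⇒⊆ (trans (sym (⊆ˢ-⟪⟫ Ω m)) Ω⊆K) (=fullˢ⇒full {Ω = ⟪ Ω ⟫} full x)))))))

  module _ (μ : Subset n → ℤ) (isMobius : IsMobius G μ) where

    sum-μ-above : ∀ Ω →
      sumℤ (subgroups G) (λ H → if Ω ⊆ˢ H then μ H else 0ℤ) ≡ (if generates G Ω then 1ℤ else 0ℤ)
    sum-μ-above Ω = begin
      sumℤ (subgroups G) (λ H → if Ω ⊆ˢ H then μ H else 0ℤ)
        ≡⟨ sumℤ-cong (subgroups G) (λ m → if-cong (⊆ˢ-⟪⟫ Ω m)) ⟩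
      sumℤ (subgroups G) (λ H → if ⟪ Ω ⟫ ⊆ˢ H then μ H else 0ℤ)
        ≡⟨ sum-map-filter μ (⟪ Ω ⟫ ⊆ˢ_) (subgroups G) ⟨
      foldr _+_ 0ℤ (map μ (filter (λ H → (⟪ Ω ⟫ ⊆ˢ H) Bool.≟ true) (subgroups G)))
        ≡⟨ isMobius ⟪ Ω ⟫ (IsSubgroup⇒isSubgroup (⟪⟫-isSubgroup Ω)) ⟩
      (if ⟪ Ω ⟫ =ˢ fullˢ then 1ℤ else 0ℤ)
        ≡⟨ if-cong (generates≡⟪⟫=fullˢ Ω) ⟨
      (if generates G Ω then 1ℤ else 0ℤ) ∎
      where open ≡-Reasoning

    mobius-inversion : ∀ (ws : List (Subset n)) (f : Subset n → ℤ) →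
      sumℤ (subgroups G) (λ K → μ K * sumℤ ws (λ Ω → if Ω ⊆ˢ K then f Ω else 0ℤ))
        ≡ sumℤ ws (λ Ω → if generates G Ω then f Ω else 0ℤ)
    mobius-inversion ws f = begin
      sumℤ Ks (λ K → μ K * sumℤ ws (λ Ω → if Ω ⊆ˢ K then f Ω else 0ℤ))
        ≡⟨ sumℤ-cong Ks (λ {K} _ → *-distribˡ-sumℤ (μ K) ws (λ Ω → if Ω ⊆ˢ K then f Ω else 0ℤ)) ⟩
      sumℤ Ks (λ K → sumℤ ws (λ Ω → μ K * (if Ω ⊆ˢ K then f Ω else 0ℤ)))
        ≡⟨ sumℤ-comm Ks ws (λ K Ω → μ K * (if Ω ⊆ˢ K then f Ω else 0ℤ)) ⟩
      sumℤ ws (λ Ω → sumℤ Ks (λ K → μ K * (if Ω ⊆ˢ K then f Ω else 0ℤ)))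
        ≡⟨ sumℤ-cong ws (λ {Ω} _ → sumℤ-cong Ks (λ {K} _ → *-indicatorʳ (μ K) (Ω ⊆ˢ K) (f Ω))) ⟩
      sumℤ ws (λ Ω → sumℤ Ks (λ K → (if Ω ⊆ˢ K then μ K else 0ℤ) * f Ω))
        ≡⟨ sumℤ-cong ws (λ {Ω} _ → *-distribʳ-sumℤ (f Ω) Ks (λ K → if Ω ⊆ˢ K then μ K else 0ℤ)) ⟨
      sumℤ ws (λ Ω → sumℤ Ks (λ K → if Ω ⊆ˢ K then μ K else 0ℤ) * f Ω)
        ≡⟨ sumℤ-cong ws (λ {Ω} _ → trans (cong (_* f Ω) (sum-μ-above Ω)) (indicator-* (generates G Ω) (f Ω))) ⟩
      sumℤ ws (λ Ω → if generates G Ω then f Ω else 0ℤ) ∎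
      where
        open ≡-Reasoning
        Ks : List (Subset n)
        Ks = subgroups G

lemma2p4 : (n : ℕ) (G : FinGroup n) (α : Fin n → Fin n) → IsAutomorphism G α → (μ : Subset n → ℤ) → IsMobius G μ → (j : ℕ) → Σₚ (allSubsets n) (λ Ω → if inG G Ω ∧ (image α Ω =ˢ Ω) then X^ ∣ Ω ∣ else 0ₚ) j ≡ Σₚ (subgroups G) (λ K → μ K •ₚ Σₚ (allSubsets n) (λ Ω → if inS G K Ω ∧ (image α Ω =ˢ Ω) then X^ ∣ Ω ∣ else 0ₚ)) j
lemma2p4 n G α _ μ isMobius j = begin
  Σₚ Ws (λ Ω → if inG G Ω ∧ fixed Ω then X^ ∣ Ω ∣ else 0ₚ) j
    ≡⟨ Σₚ-indicator-coeff Ws (λ Ω → inG G Ω ∧ fixed Ω) (X^ ∘ ∣_∣) j ⟩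
  sumℤ Ws (λ Ω → if (symmetricNoE G Ω ∧ generates G Ω) ∧ fixed Ω then X^ ∣ Ω ∣ j else 0ℤ)
    ≡⟨ sumℤ-cong Ws (λ {Ω} _ →
         trans (if-cong (regroup (symmetricNoE G Ω) (generates G Ω) (fixed Ω))) (if-∧ (generates G Ω))) ⟩
  sumℤ Ws (λ Ω → if generates G Ω then weight Ω else 0ℤ)
    ≡⟨ mobius-inversion G μ isMobius Ws weight ⟨
  sumℤ (subgroups G) (λ K → μ K * sumℤ Ws (λ Ω → if Ω ⊆ˢ K then weight Ω else 0ℤ))
    ≡⟨ sumℤ-cong (subgroups G) (λ {K} _ → cong (μ K *_) (sumℤ-cong Ws (λ {Ω} _ →
         trans (if-cong (∧-assoc (Ω ⊆ˢ K) (symmetricNoE G Ω) (fixed Ω))) (if-∧ (Ω ⊆ˢ K))))) ⟨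
  sumℤ (subgroups G) (λ K → μ K * sumℤ Ws (λ Ω → if inS G K Ω ∧ fixed Ω then X^ ∣ Ω ∣ j else 0ℤ))
    ≡⟨ sumℤ-cong (subgroups G) (λ {K} _ →
         cong (μ K *_) (Σₚ-indicator-coeff Ws (λ Ω → inS G K Ω ∧ fixed Ω) (X^ ∘ ∣_∣) j)) ⟨
  sumℤ (subgroups G) (λ K → (μ K •ₚ Σₚ Ws (λ Ω → if inS G K Ω ∧ fixed Ω then X^ ∣ Ω ∣ else 0ₚ)) j)
    ≡⟨ Σₚ-coeff (subgroups G) (λ K → μ K •ₚ Σₚ Ws (λ Ω → if inS G K Ω ∧ fixed Ω then X^ ∣ Ω ∣ else 0ₚ)) j ⟨
  Σₚ (subgroups G) (λ K → μ K •ₚ Σₚ Ws (λ Ω → if inS G K Ω ∧ fixed Ω then X^ ∣ Ω ∣ else 0ₚ)) j ∎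
  where
    open ≡-Reasoning
    Ws : List (Subset n)
    Ws = allSubsets n
    fixed : Subset n → Bool
    fixed Ω = image α Ω =ˢ Ω
    weight : Subset n → ℤ
    weight Ω = if symmetricNoE G Ω ∧ fixed Ω then X^ ∣ Ω ∣ j else 0ℤ
    regroup : ∀ s g b → (s ∧ g) ∧ b ≡ g ∧ (s ∧ b)
    regroup s g b = trans (cong (_∧ b) (∧-comm s g)) (∧-assoc g s b)
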